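{- If a graph is niche-realizable, then it has no induced path of length three (i.e., no induced path on four vertices).
   Context: All graphs are simple. A bipartite tournament is an orientation of a complete bipartite graph. The niche graph of a digraph $D$ is the graph with vertex set $V(D)$ in which distinct $u,v$ are adjacent iff there is a vertex $w$ with $(u,w),(v,w)\in A(D)$, or with $(w,u),(w,v)\in A(D)$. A graph is niche-realizable if it is the niche graph of some bipartite tournament. -}

module Defs where

open import Data.Nat using (ℕ)
open import Data.Fin using (Fin)
open import Data.Bool using (Bool)
open import Data.Product using (_×_; Σ; ∃; ∃-syntax)
open import Data.Sum using (_⊎_)
open import Relation.Nullary using (¬_)
open import Relation.Binary.PropositionalEquality using (_≡_; _≢_)
open import Function.Bundles using (_⇔_)

record Graph (n : ℕ) : Set₁ where
  field
    Adj     : Fin n → Fin n → Set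
    irrefl  : ∀ u → ¬ Adj u u
    sym     : ∀ {u v} → Adj u v → Adj v u

Digraph : ℕ → Set₁
Digraph n = Fin n → Fin n → Set

record IsBipartiteTournament {n : ℕ} (D : Digraph n) : Set where
  field
    side      : Fin n → Bool
    within    : ∀ u v → side u ≡ side v → ¬ D u v
    between   : ∀ u v → side u ≢ side v → D u v ⊎ D v u
    antisym   : ∀ u v → D u v → ¬ D v u

NicheAdj : {n : ℕ} → Digraph n → Fin n → Fin n → Set
NicheAdj D u v =
  u ≢ v × ((∃[ w ] (D u w × D v w)) ⊎ (∃[ w ] (D w u × D w v)))

NicheRealizable : {n : ℕ} → Graph n → Set₁
NicheRealizable {n} G =
  Σ (Digraph n) λ D → IsBipartiteTournament D ×
    (∀ u v → Graph.Adj G u v ⇔ NicheAdj D u v)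

HasInducedP4 : {n : ℕ} → Graph n → Set
HasInducedP4 {n} G =
  ∃[ a ] ∃[ b ] ∃[ c ] ∃[ d ]
    ( a ≢ b × a ≢ c × a ≢ d × b ≢ c × b ≢ d × c ≢ d
    × Adj a b × Adj b c × Adj c d
    × ¬ Adj a c × ¬ Adj b d × ¬ Adj a d )
  where open Graph G

-- Niche-adjacent vertices have a common neighbour, so they lie in the same part.
-- Hence an induced path a - b - c - d lies in one part, and a common neighbour w
-- of b and c lies in the other. Each of a, b, c, d is joined to w by an arc,
-- pointing either to w or away from it. Since b and c point the same way, the
-- pigeonhole principle forces one of the non-edges ac, bd, ad to join two
-- vertices pointing the same way, which would make them niche-adjacent.
module Submission where

open import Defs
open import Data.Nat using (ℕ)
open import Data.Bool.Properties using (¬-not)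
open import Data.Fin using (Fin)
open import Data.Product using (_×_; _,_; ∃-syntax)
open import Data.Sum using (_⊎_; inj₁; inj₂; [_,_]′)
open import Relation.Nullary using (¬_)
open import Relation.Binary.PropositionalEquality using (_≡_; _≢_; sym; trans)
open import Function.Bundles using (Equivalence)

module _ {n : ℕ} (D : Digraph n) where

  Joined : Fin n → Fin n → Set
  Joined w u = D u w ⊎ D w u

  SameDirectionAt : Fin n → Fin n → Fin n → Set
  SameDirectionAt w u v = (D u w × D v w) ⊎ (D w u × D w v)

  sameDirectionAt⇒joined : ∀ {w u v} → SameDirectionAt w u v → Joined w u × Joined w v
  sameDirectionAt⇒joined (inj₁ (uw , vw)) = inj₁ uw , inj₁ vw
  sameDirectionAt⇒joined (inj₂ (wu , wv)) = inj₂ wu , inj₂ wv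

  sameDirectionAt-pigeonhole : ∀ {w a b c d} → Joined w a → Joined w d →
    SameDirectionAt w b c →
    SameDirectionAt w a c ⊎ SameDirectionAt w b d ⊎ SameDirectionAt w a d
  sameDirectionAt-pigeonhole (inj₁ aw) _         (inj₁ (_ , cw))  = inj₁ (inj₁ (aw , cw))
  sameDirectionAt-pigeonhole (inj₂ _)  (inj₁ dw) (inj₁ (bw , _))  = inj₂ (inj₁ (inj₁ (bw , dw)))
  sameDirectionAt-pigeonhole (inj₂ wa) (inj₂ wd) (inj₁ _)         = inj₂ (inj₂ (inj₂ (wa , wd)))
  sameDirectionAt-pigeonhole (inj₂ wa) _         (inj₂ (_ , wc))  = inj₁ (inj₂ (wa , wc))
  sameDirectionAt-pigeonhole (inj₁ _)  (inj₂ wd) (inj₂ (wb , _))  = inj₂ (inj₁ (inj₂ (wb , wd)))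
  sameDirectionAt-pigeonhole (inj₁ aw) (inj₁ dw) (inj₂ _)         = inj₂ (inj₂ (inj₁ (aw , dw)))

  nicheAdj⇒sameDirectionAt : ∀ {u v} → NicheAdj D u v → ∃[ w ] SameDirectionAt w u v
  nicheAdj⇒sameDirectionAt (_ , inj₁ (w , uw , vw)) = w , inj₁ (uw , vw)
  nicheAdj⇒sameDirectionAt (_ , inj₂ (w , wu , wv)) = w , inj₂ (wu , wv)

  sameDirectionAt⇒nicheAdj : ∀ {w u v} → u ≢ v → SameDirectionAt w u v → NicheAdj D u v
  sameDirectionAt⇒nicheAdj u≢v (inj₁ (uw , vw)) = u≢v , inj₁ (_ , uw , vw)
  sameDirectionAt⇒nicheAdj u≢v (inj₂ (wu , wv)) = u≢v , inj₂ (_ , wu , wv)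

module _ {n : ℕ} {D : Digraph n} (bt : IsBipartiteTournament D) where
  open IsBipartiteTournament bt

  joined⇒side-≢ : ∀ {w u} → Joined D w u → side u ≢ side w
  joined⇒side-≢ {w} {u} (inj₁ uw) eq = within u w eq uw
  joined⇒side-≢ {w} {u} (inj₂ wu) eq = within w u (sym eq) wu

  sameDirectionAt⇒side-≡ : ∀ {w u v} → SameDirectionAt D w u v → side u ≡ side v
  sameDirectionAt⇒side-≡ u∼v with sameDirectionAt⇒joined D u∼v
  ... | wu , wv = trans (¬-not (joined⇒side-≢ wu)) (sym (¬-not (joined⇒side-≢ wv)))

  nicheAdj⇒side-≡ : ∀ {u v} → NicheAdj D u v → side u ≡ side v
  nicheAdj⇒side-≡ u∼v with nicheAdj⇒sameDirectionAt D u∼v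
  ... | _ , u∼v-at-w = sameDirectionAt⇒side-≡ u∼v-at-w

  joined-across : ∀ {w u v} → side u ≡ side v → Joined D w v → Joined D w u
  joined-across {w} {u} u≡v wv = between u w (λ u≡w → joined⇒side-≢ wv (trans (sym u≡v) u≡w))

  sameDirectionAt-path : ∀ {w a b c d} → side a ≡ side b → side d ≡ side c →
    SameDirectionAt D w b c →
    SameDirectionAt D w a c ⊎ SameDirectionAt D w b d ⊎ SameDirectionAt D w a d
  sameDirectionAt-path a≡b d≡c b∼c with sameDirectionAt⇒joined D b∼c
  ... | wb , wc = sameDirectionAt-pigeonhole D (joined-across a≡b wb) (joined-across d≡c wc) b∼c

proposition2p13 : (n : ℕ) (G : Graph n) → NicheRealizable G → ¬ HasInducedP4 G
proposition2p13 n G (D , bt , adj⇔niche)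
  (a , b , c , d , _ , a≢c , a≢d , _ , b≢d , _ , ab , bc , cd , ¬ac , ¬bd , ¬ad) =
  let _ , b∼c = nicheAdj⇒sameDirectionAt D (adjacent bc) in
  [ nonadjacent a≢c ¬ac , [ nonadjacent b≢d ¬bd , nonadjacent a≢d ¬ad ]′ ]′
    (sameDirectionAt-path bt (side-≡ ab) (sym (side-≡ cd)) b∼c)
  where
  open Graph G using (Adj)
  open IsBipartiteTournament bt using (side)

  adjacent : ∀ {u v} → Adj u v → NicheAdj D u v
  adjacent {u} {v} = Equivalence.to (adj⇔niche u v)

  side-≡ : ∀ {u v} → Adj u v → side u ≡ side v
  side-≡ uv = nicheAdj⇒side-≡ bt (adjacent uv)

  nonadjacent : ∀ {w u v} → u ≢ v → ¬ Adj u v → ¬ SameDirectionAt D w u v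
  nonadjacent {u = u} {v} u≢v ¬uv u∼v =
    ¬uv (Equivalence.from (adj⇔niche u v) (sameDirectionAt⇒nicheAdj D u≢v u∼v))
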